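{- Let $G$ be a graph with exactly two connected components and let $k\ge 3$ be an integer. Then $(G,k)$ is niche-realizable if and only if $k=3$ and $G$ is isomorphic to an expansion of $P_3 \cup K_1$.
   Context: All graphs are simple; $P_3$ is the path on $3$ vertices and $P_3\cup K_1$ is its disjoint union with an isolated vertex. A $k$-partite tournament is an orientation of a complete $k$-partite graph with $k$ nonempty partite sets. The niche graph $\mathcal{N}(D)$ of a digraph $D$ has vertex set $V(D)$, and two distinct vertices $u,v$ are adjacent iff they have a common out-neighbor in $D$ or a common in-neighbor in $D$. The pair $(G,k)$ is niche-realizable if $G$ is isomorphic to the niche graph of some $k$-partite tournament. Replacing a vertex $v$ of a graph $H$ by a clique on a finite nonempty set $K$ disjoint from $V(H)$ gives the graph with vertex set $(V(H)\cup K)\setminus\{v\}$ and edge set $E(H-v)\cup\{wx : w\ne x,\ w,x\in K\}\cup\{uw : uv\in E(H),\ w\in K\}$. An expansion of $H$ is a graph obtained by replacing each vertex of $H$ by a clique (possibly of size $1$). -}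

module Defs where

open import Data.Nat using (ℕ)
open import Data.Fin using (Fin; zero; suc)
open import Data.Product using (Σ; ∃; _×_; _,_)
open import Data.Sum using (_⊎_)
open import Data.Empty using (⊥)
open import Relation.Nullary using (¬_)
open import Relation.Binary.PropositionalEquality using (_≡_; _≢_)
open import Function.Definitions using (Bijective)
open import Function.Bundles using (_⇔_)

record Graph (n : ℕ) : Set₁ where
  field
    Adj    : Fin n → Fin n → Set
    sym    : ∀ {u v} → Adj u v → Adj v u
    irrefl : ∀ {v} → ¬ Adj v v
open Graph public

record _≅_ {n m : ℕ} (G : Graph n) (H : Graph m) : Set where
  field
    f    : Fin n → Fin m
    bij  : Bijective _≡_ _≡_ f
    pres : ∀ u v → Adj G u v ⇔ Adj H (f u) (f v)

data Reach {n : ℕ} (G : Graph n) : Fin n → Fin n → Set where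
  here : ∀ {v} → Reach G v v
  step : ∀ {u v w} → Adj G u v → Reach G v w → Reach G u w

TwoComponents : {n : ℕ} → Graph n → Set
TwoComponents {n} G =
  Σ (Fin n) λ a → Σ (Fin n) λ b →
    ¬ Reach G a b × (∀ w → Reach G a w ⊎ Reach G b w)

record MultipartiteTournament (k m : ℕ) : Set₁ where
  field
    Arc  : Fin m → Fin m → Set
    part : Fin m → Fin k
    part-surj : ∀ (i : Fin k) → ∃ λ v → part v ≡ i
    no-arc-within : ∀ u v → part u ≡ part v → ¬ Arc u v
    complete : ∀ u v → part u ≢ part v → Arc u v ⊎ Arc v u
    oriented : ∀ u v → Arc u v → ¬ Arc v u
open MultipartiteTournament public

NicheAdj : {k m : ℕ} → MultipartiteTournament k m → Fin m → Fin m → Set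
NicheAdj D u v =
  u ≢ v × ((∃ λ w → Arc D u w × Arc D v w) ⊎ (∃ λ w → Arc D w u × Arc D w v))

private
  ≢-sym : ∀ {m} {u v : Fin m} → u ≢ v → v ≢ u
  ≢-sym p q = p (Relation.Binary.PropositionalEquality.sym q)

  niche-sym : ∀ {k m} (D : MultipartiteTournament k m) {u v : Fin m} →
              NicheAdj D u v → NicheAdj D v u
  niche-sym D (ne , Data.Sum.inj₁ (w , a , b)) = ≢-sym ne , Data.Sum.inj₁ (w , b , a)
  niche-sym D (ne , Data.Sum.inj₂ (w , a , b)) = ≢-sym ne , Data.Sum.inj₂ (w , b , a)

  niche-irrefl : ∀ {k m} (D : MultipartiteTournament k m) {v : Fin m} →
                 ¬ NicheAdj D v v
  niche-irrefl D (ne , _) = ne Relation.Binary.PropositionalEquality.refl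

NicheGraph : {k m : ℕ} → MultipartiteTournament k m → Graph m
NicheGraph D = record
  { Adj = NicheAdj D ; sym = niche-sym D ; irrefl = niche-irrefl D }

NicheRealizable : {n : ℕ} → Graph n → ℕ → Set₁
NicheRealizable G k =
  Σ ℕ λ m → Σ (MultipartiteTournament k m) λ D → G ≅ NicheGraph D

data P3K1Adj : Fin 4 → Fin 4 → Set where
  e01 : P3K1Adj zero (suc zero)
  e10 : P3K1Adj (suc zero) zero
  e12 : P3K1Adj (suc zero) (suc (suc zero))
  e21 : P3K1Adj (suc (suc zero)) (suc zero)

private
  p-sym : ∀ {u v} → P3K1Adj u v → P3K1Adj v u
  p-sym e01 = e10
  p-sym e10 = e01
  p-sym e12 = e21
  p-sym e21 = e12

  p-irrefl : ∀ {v} → ¬ P3K1Adj v v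
  p-irrefl ()

P3∪K1 : Graph 4
P3∪K1 = record { Adj = P3K1Adj ; sym = p-sym ; irrefl = p-irrefl }

-- An expansion of H replaces each vertex h of H by a nonempty clique K_h;
-- two new vertices x ∈ K_h, y ∈ K_h' are adjacent iff x ≠ y and
-- (h = h' or hh' ∈ E(H)).  G is isomorphic to an expansion of H iff its
-- vertex set can be labelled by π : V(G) → V(H), with every fibre
-- π⁻¹(h) = K_h nonempty, so that this adjacency rule holds.

ExpansionAdj : {n h : ℕ} → Graph h → (Fin n → Fin h) → Fin n → Fin n → Set
ExpansionAdj H π x y = x ≢ y × (π x ≡ π y ⊎ Adj H (π x) (π y))

IsoToExpansionOf : {n h : ℕ} → Graph n → Graph h → Set
IsoToExpansionOf {n} {h} G H =
  Σ (Fin n → Fin h) λ π →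
    (∀ (j : Fin h) → ∃ λ x → π x ≡ j) ×
    (∀ x y → Adj G x y ⇔ ExpansionAdj H π x y)

-- Colour each vertex of D by the component of the niche graph containing it; vertices with a
-- common in- or out-neighbour get the same colour. If both colour classes met two partite
-- sets, an arc inside one class and two suitably placed vertices of the other would give two
-- differently coloured vertices a common neighbour. So some colour class lies in a single
-- partite set P; fix a vertex a in it. Every vertex outside P has the other colour and is an
-- out-neighbour (class S) or an in-neighbour (class T) of a. S and T each lie in one partite
-- set, hence k = 3, and together with the remaining vertices M of P the arcs of D are exactly
-- those of the pattern  A → S → T → A,  S → M → T,  where A is the component of a. The common
-- neighbours in this pattern make the niche graph the expansion of the path S – M – T plus
-- the isolated class A. Conversely, blowing up the pattern realizes every such expansion.

module Submission where

open import Defs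
open import Data.Nat using (ℕ; _≤_; _<_; s≤s; z≤n)
open import Data.Nat.Properties using (≤-trans; m≤n⇒m<n∨m≡n)
open import Data.Fin using (Fin) renaming (_<_ to _<ᶠ_)
open import Data.Fin.Patterns using (0F; 1F; 2F; 3F)
open import Data.Fin.Properties using (any?; all?; pigeonhole; <⇒≢) renaming (_≟_ to _≟ᶠ_)
open import Data.Vec using (Vec; []; _∷_; lookup)
open import Data.Product using (_×_; ∃; _,_; proj₁; proj₂) renaming (map to ×-map)
open import Data.Sum as Sum using (_⊎_; inj₁; inj₂; [_,_]′)
open import Data.Empty using (⊥; ⊥-elim)
open import Function using (_∘_; id)
open import Function.Bundles using (_⇔_; mk⇔; Equivalence)
open import Function.Construct.Identity using (bijective)
open import Function.Properties.Equivalence using () renaming (trans to ⇔-trans; sym to ⇔-sym)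
open import Relation.Nullary using (¬_; Dec; yes; no)
open import Relation.Nullary.Decidable using (_×-dec_; ¬?)
open import Relation.Binary.PropositionalEquality as ≡
  using (_≡_; _≢_; refl; trans; cong; subst; subst₂)
open ≡.≡-Reasoning

∃-avoiding : ∀ {j k} → j < k → (xs : Vec (Fin k) j) →
             ∃ λ r → ∀ i → r ≢ lookup xs i
∃-avoiding {j} {k} j<k xs with any? (λ r → all? (λ i → ¬? (r ≟ᶠ lookup xs i)))
... | yes avoiding = avoiding
... | no  none     = collision (pigeonhole j<k (proj₁ ∘ index))
  where
  index : ∀ r → ∃ λ i → r ≡ lookup xs i
  index r with any? (λ i → r ≟ᶠ lookup xs i)
  ... | yes hit  = hit
  ... | no  miss = ⊥-elim (none (r , λ i r≡xᵢ → miss (i , r≡xᵢ)))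

  collision : (∃ λ r → ∃ λ r′ → r <ᶠ r′ × proj₁ (index r) ≡ proj₁ (index r′)) →
              ∃ λ r → ∀ i → r ≢ lookup xs i
  collision (r , r′ , r<r′ , same) = ⊥-elim (<⇒≢ r<r′ (begin
    r                              ≡⟨ proj₂ (index r) ⟩
    lookup xs (proj₁ (index r))    ≡⟨ cong (lookup xs) same ⟩
    lookup xs (proj₁ (index r′))   ≡⟨ ≡.sym (proj₂ (index r′)) ⟩
    r′                             ∎))

module _ {n : ℕ} {G : Graph n} where

  Reach-trans : ∀ {u v w} → Reach G u v → Reach G v w → Reach G u w
  Reach-trans here       r = r
  Reach-trans (step e q) r = step e (Reach-trans q r)

  Reach-sym : ∀ {u v} → Reach G u v → Reach G v u
  Reach-sym here       = here
  Reach-sym (step e r) = Reach-trans (Reach-sym r) (step (Graph.sym G e) here)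

Reach-map : ∀ {n n′} {G : Graph n} {H : Graph n′} (h : Fin n → Fin n′) →
            (∀ {u v} → Adj G u v → Adj H (h u) (h v)) →
            ∀ {u v} → Reach G u v → Reach H (h u) (h v)
Reach-map h hom here       = here
Reach-map h hom (step e r) = step (hom e) (Reach-map h hom r)

module _ {n n′ : ℕ} {G : Graph n} {H : Graph n′} (G≅H : G ≅ H) where
  open _≅_ G≅H

  private
    f⁻¹ : Fin n′ → Fin n
    f⁻¹ y = proj₁ (proj₂ bij y)

    f∘f⁻¹ : ∀ y → f (f⁻¹ y) ≡ y
    f∘f⁻¹ y = proj₂ (proj₂ bij y) refl

    f⁻¹∘f : ∀ x → f⁻¹ (f x) ≡ x
    f⁻¹∘f x = proj₁ bij (f∘f⁻¹ (f x))

    f-hom : ∀ {u v} → Adj G u v → Adj H (f u) (f v)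
    f-hom {u} {v} = Equivalence.to (pres u v)

    f⁻¹-hom : ∀ {u v} → Adj H u v → Adj G (f⁻¹ u) (f⁻¹ v)
    f⁻¹-hom {u} {v} e = Equivalence.from (pres (f⁻¹ u) (f⁻¹ v))
      (subst₂ (Adj H) (≡.sym (f∘f⁻¹ u)) (≡.sym (f∘f⁻¹ v)) e)

  ≅-TwoComponents : TwoComponents G → TwoComponents H
  ≅-TwoComponents (a , b , a↮b , cover) =
    f a , f b , separated , λ w → Sum.map (into w) (into w) (cover (f⁻¹ w))
    where
    separated : ¬ Reach H (f a) (f b)
    separated r =
      a↮b (subst₂ (Reach G) (f⁻¹∘f a) (f⁻¹∘f b) (Reach-map f⁻¹ f⁻¹-hom r))

    into : ∀ {x} w → Reach G x (f⁻¹ w) → Reach H (f x) w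
    into {x} w r = subst (Reach H (f x)) (f∘f⁻¹ w) (Reach-map f f-hom r)

  ≅-IsoToExpansionOf : ∀ {h} {K : Graph h} → IsoToExpansionOf H K → IsoToExpansionOf G K
  ≅-IsoToExpansionOf {K = K} (π , π-surjective , adj⇔) =
    π ∘ f , surjective , λ x y →
      ⇔-trans (pres x y) (⇔-trans (adj⇔ (f x) (f y)) (pullback x y))
    where
    surjective : ∀ j → ∃ λ x → π (f x) ≡ j
    surjective j with π-surjective j
    ... | y , πy≡j = f⁻¹ y , trans (cong π (f∘f⁻¹ y)) πy≡j

    pullback : ∀ x y → ExpansionAdj K π (f x) (f y) ⇔ ExpansionAdj K (π ∘ f) x y
    pullback x y = mk⇔ (λ (fx≢fy , r) → fx≢fy ∘ cong f , r)
                       (λ (x≢y , r) → x≢y ∘ proj₁ bij , r)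

CommonNeighbour : ∀ {h} → (Fin h → Fin h → Set) → Fin h → Fin h → Set
CommonNeighbour R i j = (∃ λ c → R i c × R j c) ⊎ (∃ λ c → R c i × R c j)

module BlowUp {h : ℕ} {H : Graph h} (R : Fin h → Fin h → Set)
  (R-niche : ∀ i j → CommonNeighbour R i j ⇔ (i ≡ j ⊎ Adj H i j))
  {k m : ℕ} (D : MultipartiteTournament k m) (π : Fin m → Fin h)
  (arc⇔ : ∀ x y → Arc D x y ⇔ R (π x) (π y)) where

  private
    arc⇒ : ∀ {x y} → Arc D x y → R (π x) (π y)
    arc⇒ = Equivalence.to (arc⇔ _ _)

    arc⇐ : ∀ {x y} → R (π x) (π y) → Arc D x y
    arc⇐ = Equivalence.from (arc⇔ _ _)

    commonNeighbour⇒ : ∀ {x y} → CommonNeighbour (Arc D) x y →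
                       CommonNeighbour R (π x) (π y)
    commonNeighbour⇒ (inj₁ (w , xw , yw)) = inj₁ (π w , arc⇒ xw , arc⇒ yw)
    commonNeighbour⇒ (inj₂ (w , wx , wy)) = inj₂ (π w , arc⇒ wx , arc⇒ wy)

    commonNeighbour⇐ : (∀ c → ∃ λ w → π w ≡ c) → ∀ {x y} →
                       CommonNeighbour R (π x) (π y) → CommonNeighbour (Arc D) x y
    commonNeighbour⇐ surj (inj₁ (c , xc , yc)) with surj c
    ... | w , refl = inj₁ (w , arc⇐ xc , arc⇐ yc)
    commonNeighbour⇐ surj (inj₂ (c , cx , cy)) with surj c
    ... | w , refl = inj₂ (w , arc⇐ cx , arc⇐ cy)

  nicheAdj⇒expansionAdj : ∀ {x y} → NicheAdj D x y → ExpansionAdj H π x y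
  nicheAdj⇒expansionAdj {x} {y} (x≢y , common) =
    x≢y , Equivalence.to (R-niche (π x) (π y)) (commonNeighbour⇒ common)

  nicheAdj⇔expansionAdj : (∀ c → ∃ λ w → π w ≡ c) →
                          ∀ x y → NicheAdj D x y ⇔ ExpansionAdj H π x y
  nicheAdj⇔expansionAdj surj x y = mk⇔ nicheAdj⇒expansionAdj λ (x≢y , r) →
    x≢y , commonNeighbour⇐ surj (Equivalence.from (R-niche (π x) (π y)) r)

blowUp : ∀ {k h n} (T : MultipartiteTournament k h) (π : Fin n → Fin h) →
         (∀ j → ∃ λ x → π x ≡ j) → MultipartiteTournament k n
blowUp T π surj = record
  { Arc           = λ x y → Arc T (π x) (π y)
  ; part          = part T ∘ π
  ; part-surj     = part-surj′
  ; no-arc-within = λ x y → no-arc-within T (π x) (π y)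
  ; complete      = λ x y → complete T (π x) (π y)
  ; oriented      = λ x y → oriented T (π x) (π y)
  }
  where
  part-surj′ : ∀ i → ∃ λ x → part T (π x) ≡ i
  part-surj′ i with part-surj T i
  ... | j , e with surj j
  ...   | x , refl = x , e

arcs-determined : ∀ {k k′ m h}
  (D : MultipartiteTournament k m) (T : MultipartiteTournament k′ h)
  (π : Fin m → Fin h) (ρ : Fin k′ → Fin k) →
  (∀ x → part D x ≡ ρ (part T (π x))) →
  (∀ {x y} → Arc T (π x) (π y) → Arc D x y) →
  ∀ x y → Arc D x y ⇔ Arc T (π x) (π y)
arcs-determined D T π ρ part≡ lift x y = mk⇔ descend lift
  where
  descend : Arc D x y → Arc T (π x) (π y)
  descend xy with part T (π x) ≟ᶠ part T (π y)
  ... | yes same = ⊥-elim (no-arc-within D x y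
          (trans (part≡ x) (trans (cong ρ same) (≡.sym (part≡ y)))) xy)
  ... | no differ = [ id , (λ yx → ⊥-elim (oriented D x y xy (lift yx))) ]′
                      (complete T (π x) (π y) differ)

-- Vertices 0F, 1F, 2F stand for the classes S, M, T, and 3F for the component A.
data PatternArc : Fin 4 → Fin 4 → Set where
  arc₃₀ : PatternArc 3F 0F
  arc₀₂ : PatternArc 0F 2F
  arc₂₃ : PatternArc 2F 3F
  arc₀₁ : PatternArc 0F 1F
  arc₁₂ : PatternArc 1F 2F

patternPart : Fin 4 → Fin 3
patternPart 0F = 1F
patternPart 1F = 0F
patternPart 2F = 2F
patternPart 3F = 0F

Pattern : MultipartiteTournament 3 4
Pattern = record
  { Arc           = PatternArc
  ; part          = patternPart
  ; part-surj     = λ { 0F → 1F , refl ; 1F → 0F , refl ; 2F → 2F , refl }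
  ; no-arc-within = no-arc-within′
  ; complete      = complete′
  ; oriented      = oriented′
  }
  where
  no-arc-within′ : ∀ i j → patternPart i ≡ patternPart j → ¬ PatternArc i j
  no-arc-within′ _ _ () arc₃₀
  no-arc-within′ _ _ () arc₀₂
  no-arc-within′ _ _ () arc₂₃
  no-arc-within′ _ _ () arc₀₁
  no-arc-within′ _ _ () arc₁₂

  complete′ : ∀ i j → patternPart i ≢ patternPart j → PatternArc i j ⊎ PatternArc j i
  complete′ 0F 1F _   = inj₁ arc₀₁
  complete′ 0F 2F _   = inj₁ arc₀₂
  complete′ 0F 3F _   = inj₂ arc₃₀
  complete′ 1F 0F _   = inj₂ arc₀₁
  complete′ 1F 2F _   = inj₁ arc₁₂
  complete′ 2F 0F _   = inj₂ arc₀₂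
  complete′ 2F 1F _   = inj₂ arc₁₂
  complete′ 2F 3F _   = inj₁ arc₂₃
  complete′ 3F 0F _   = inj₁ arc₃₀
  complete′ 3F 2F _   = inj₂ arc₂₃
  complete′ 0F 0F i≢j = ⊥-elim (i≢j refl)
  complete′ 1F 1F i≢j = ⊥-elim (i≢j refl)
  complete′ 1F 3F i≢j = ⊥-elim (i≢j refl)
  complete′ 2F 2F i≢j = ⊥-elim (i≢j refl)
  complete′ 3F 1F i≢j = ⊥-elim (i≢j refl)
  complete′ 3F 3F i≢j = ⊥-elim (i≢j refl)

  oriented′ : ∀ i j → PatternArc i j → ¬ PatternArc j i
  oriented′ _ _ arc₃₀ ()
  oriented′ _ _ arc₀₂ ()
  oriented′ _ _ arc₂₃ ()
  oriented′ _ _ arc₀₁ ()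
  oriented′ _ _ arc₁₂ ()

pattern-commonNeighbour⇔ : ∀ i j →
  CommonNeighbour PatternArc i j ⇔ (i ≡ j ⊎ P3K1Adj i j)
pattern-commonNeighbour⇔ i j = mk⇔ [ (λ (_ , ic , jc) → commonOut ic jc)
                                   , (λ (_ , ci , cj) → commonIn ci cj) ]′ witness
  where
  commonOut : ∀ {i j c} → PatternArc i c → PatternArc j c → i ≡ j ⊎ P3K1Adj i j
  commonOut arc₃₀ arc₃₀ = inj₁ refl
  commonOut arc₀₂ arc₀₂ = inj₁ refl
  commonOut arc₀₂ arc₁₂ = inj₂ e01
  commonOut arc₁₂ arc₀₂ = inj₂ e10
  commonOut arc₁₂ arc₁₂ = inj₁ refl
  commonOut arc₂₃ arc₂₃ = inj₁ refl
  commonOut arc₀₁ arc₀₁ = inj₁ refl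

  commonIn : ∀ {i j c} → PatternArc c i → PatternArc c j → i ≡ j ⊎ P3K1Adj i j
  commonIn arc₃₀ arc₃₀ = inj₁ refl
  commonIn arc₀₂ arc₀₂ = inj₁ refl
  commonIn arc₀₂ arc₀₁ = inj₂ e21
  commonIn arc₀₁ arc₀₂ = inj₂ e12
  commonIn arc₀₁ arc₀₁ = inj₁ refl
  commonIn arc₂₃ arc₂₃ = inj₁ refl
  commonIn arc₁₂ arc₁₂ = inj₁ refl

  witness : ∀ {i j} → i ≡ j ⊎ P3K1Adj i j → CommonNeighbour PatternArc i j
  witness {0F} (inj₁ refl) = inj₂ (3F , arc₃₀ , arc₃₀)
  witness {1F} (inj₁ refl) = inj₁ (2F , arc₁₂ , arc₁₂)
  witness {2F} (inj₁ refl) = inj₁ (3F , arc₂₃ , arc₂₃)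
  witness {3F} (inj₁ refl) = inj₁ (0F , arc₃₀ , arc₃₀)
  witness (inj₂ e01) = inj₁ (2F , arc₀₂ , arc₁₂)
  witness (inj₂ e10) = inj₁ (2F , arc₁₂ , arc₀₂)
  witness (inj₂ e12) = inj₂ (0F , arc₀₁ , arc₀₂)
  witness (inj₂ e21) = inj₂ (0F , arc₀₂ , arc₀₁)

module PatternBlowUp = BlowUp {H = P3∪K1} PatternArc pattern-commonNeighbour⇔

expansion⇒realizable : ∀ {n} {G : Graph n} →
                       IsoToExpansionOf G P3∪K1 → NicheRealizable G 3
expansion⇒realizable {n} (π , surj , adj⇔) = n , D , record
  { f    = id
  ; bij  = bijective _≡_
  ; pres = λ x y → ⇔-trans (adj⇔ x y) (⇔-sym (nicheAdj⇔expansionAdj surj x y))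
  }
  where
  D : MultipartiteTournament 3 n
  D = blowUp Pattern π surj
  open PatternBlowUp D π (λ x y → mk⇔ id id)

walk-meets-middle : ∀ {n} {G : Graph n} (π : Fin n → Fin 4) →
  (∀ {x y} → Adj G x y → π x ≡ π y ⊎ P3K1Adj (π x) (π y)) →
  ∀ {x y} → Reach G x y → π x ≡ 0F → π y ≡ 2F → ∃ λ w → π w ≡ 1F
walk-meets-middle π hom here πx≡0 πx≡2 with trans (≡.sym πx≡0) πx≡2
... | ()
walk-meets-middle π hom (step {v = z} e r) πx≡0 πy≡2 with hom e
... | inj₁ πx≡πz = walk-meets-middle π hom r (trans (≡.sym πx≡πz) πx≡0) πy≡2
... | inj₂ adj   = z , next-to-end (subst (λ i → P3K1Adj i (π z)) πx≡0 adj)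
  where
  next-to-end : ∀ {j} → P3K1Adj 0F j → j ≡ 1F
  next-to-end e01 = refl

module Niche {k m : ℕ} (D : MultipartiteTournament k m) where

  infix 4 _↝_
  _↝_ : Fin m → Fin m → Set
  _↝_ = Reach (NicheGraph D)

  commonIn⇒↝ : ∀ {x y z} → Arc D x y → Arc D x z → y ↝ z
  commonIn⇒↝ {x} {y} {z} xy xz with y ≟ᶠ z
  ... | yes refl = here
  ... | no  y≢z  = step (y≢z , inj₂ (x , xy , xz)) here

  commonOut⇒↝ : ∀ {x y z} → Arc D y x → Arc D z x → y ↝ z
  commonOut⇒↝ {x} {y} {z} yx zx with y ≟ᶠ z
  ... | yes refl = here
  ... | no  y≢z  = step (y≢z , inj₁ (x , yx , zx)) here

  arc-unless-reversed : ∀ {x y} → part D x ≢ part D y → ¬ Arc D y x → Arc D x y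
  arc-unless-reversed {x} {y} x≢y ¬yx = [ id , ⊥-elim ∘ ¬yx ]′ (complete D x y x≢y)

  vertex-avoiding : ∀ {j} → j < k → (ps : Vec (Fin k) j) →
                    ∃ λ z → ∀ i → part D z ≢ lookup ps i
  vertex-avoiding j<k ps with ∃-avoiding j<k ps
  ... | r , r∉ps with part-surj D r
  ...   | z , refl = z , r∉ps

  Confined Spread : Fin m → Set
  Confined a = ∀ {v} → a ↝ v → part D v ≡ part D a
  Spread   a = ∃ λ v → a ↝ v × part D v ≢ part D a

  module Components (k≥3 : 3 ≤ k) (a b : Fin m) (a↮b : ¬ a ↝ b)
    (cover : ∀ v → a ↝ v ⊎ b ↝ v) where

    apart : ∀ {u v} → a ↝ u → b ↝ v → ¬ u ↝ v
    apart a↝u b↝v u↝v = a↮b (Reach-trans a↝u (Reach-trans u↝v (Reach-sym b↝v)))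

    a↝? : ∀ v → Dec (a ↝ v)
    a↝? v = [ yes , (λ b↝v → no λ a↝v → apart a↝v b↝v here) ]′ (cover v)

    confined-or-spread : Confined a ⊎ Spread a
    confined-or-spread with any? (λ v → a↝? v ×-dec ¬? (part D v ≟ᶠ part D a))
    ... | yes spread = inj₂ spread
    ... | no  none   = inj₁ confined
      where
      confined : Confined a
      confined {v} a↝v with part D v ≟ᶠ part D a
      ... | yes v∈a = v∈a
      ... | no  v∉a = ⊥-elim (none (v , a↝v , v∉a))

    arc⇒¬outsider-pair : ∀ {x₁ x₂ z y} → a ↝ x₁ → a ↝ x₂ → b ↝ z → b ↝ y →
      Arc D x₁ x₂ → part D z ≢ part D x₁ → part D z ≢ part D x₂ →
      part D y ≢ part D z → ⊥
    arc⇒¬outsider-pair {x₁} {x₂} {z} {y} a↝x₁ a↝x₂ b↝z b↝y x₁x₂ z∉x₁ z∉x₂ y∉z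
      with complete D x₁ z (z∉x₁ ∘ ≡.sym)
    ... | inj₁ x₁z = apart a↝x₂ b↝z (commonIn⇒↝ x₁x₂ x₁z)
    ... | inj₂ zx₁ with complete D x₂ z (z∉x₂ ∘ ≡.sym)
    ...   | inj₂ zx₂ = apart a↝x₁ b↝z (commonOut⇒↝ x₁x₂ zx₂)
    ...   | inj₁ x₂z with complete D z y (y∉z ∘ ≡.sym)
    ...     | inj₁ zy = apart a↝x₁ b↝y (commonIn⇒↝ zx₁ zy)
    ...     | inj₂ yz = apart a↝x₂ b↝y (commonOut⇒↝ x₂z yz)

    outsider-confines : ∀ {x₁ x₂ z} → a ↝ x₁ → a ↝ x₂ → part D x₁ ≢ part D x₂ →
      b ↝ z → part D z ≢ part D x₁ → part D z ≢ part D x₂ →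
      ∀ {y} → b ↝ y → part D y ≡ part D z
    outsider-confines {x₁} {x₂} {z} a↝x₁ a↝x₂ x₁≢x₂ b↝z z∉x₁ z∉x₂ {y} b↝y
      with part D y ≟ᶠ part D z
    ... | yes y∈z = y∈z
    ... | no  y∉z with complete D x₁ x₂ x₁≢x₂
    ...   | inj₁ x₁x₂ =
            ⊥-elim (arc⇒¬outsider-pair a↝x₁ a↝x₂ b↝z b↝y x₁x₂ z∉x₁ z∉x₂ y∉z)
    ...   | inj₂ x₂x₁ =
            ⊥-elim (arc⇒¬outsider-pair a↝x₂ a↝x₁ b↝z b↝y x₂x₁ z∉x₂ z∉x₁ y∉z)

    ¬spread-sharing-part : ∀ {x₁ x₂ y} → a ↝ x₁ → a ↝ x₂ → part D x₁ ≢ part D x₂ →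
      part D b ≡ part D x₁ → b ↝ y → part D y ≢ part D b → ⊥
    ¬spread-sharing-part {x₁} {x₂} a↝x₁ a↝x₂ x₁≢x₂ b∈x₁ b↝y y∉b
      with vertex-avoiding k≥3 (part D x₁ ∷ part D x₂ ∷ [])
    ... | z , z∉ with cover z
    ...   | inj₂ b↝z = z∉ 0F (trans (≡.sym b∈z) b∈x₁)
      where
      b∈z : part D b ≡ part D z
      b∈z = outsider-confines a↝x₁ a↝x₂ x₁≢x₂ b↝z (z∉ 0F) (z∉ 1F) here
    ...   | inj₁ a↝z = y∉b (outsider-confines a↝x₂ a↝z (z∉ 1F ∘ ≡.sym) here b∉x₂ b∉z b↝y)
      where
      b∉x₂ : part D b ≢ part D x₂
      b∉x₂ b∈x₂ = x₁≢x₂ (trans (≡.sym b∈x₁) b∈x₂)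

      b∉z : part D b ≢ part D z
      b∉z b∈z = z∉ 0F (trans (≡.sym b∈z) b∈x₁)

    ¬both-spread : Spread a → Spread b → ⊥
    ¬both-spread (x , a↝x , x∉a) (y , b↝y , y∉b)
      with part D b ≟ᶠ part D a | part D b ≟ᶠ part D x
    ... | yes b∈a | _       = ¬spread-sharing-part here a↝x (x∉a ∘ ≡.sym) b∈a b↝y y∉b
    ... | no  _   | yes b∈x = ¬spread-sharing-part a↝x here x∉a b∈x b↝y y∉b
    ... | no  b∉a | no  b∉x =
          y∉b (outsider-confines here a↝x (x∉a ∘ ≡.sym) here b∉a b∉x b↝y)

    module WhenConfined (confined : Confined a) where

      P : Fin k
      P = part D a

      outside⇒b : ∀ {v} → part D v ≢ P → b ↝ v
      outside⇒b {v} v∉P = [ (λ a↝v → ⊥-elim (v∉P (confined a↝v))) , id ]′ (cover v)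

      outside-arc-triangle : ∀ {u v} → part D u ≢ P → part D v ≢ P → Arc D u v →
                             Arc D a u × Arc D v a
      outside-arc-triangle {u} {v} u∉P v∉P uv = a→u , v→a
        where
        a→u : Arc D a u
        a→u = arc-unless-reversed (u∉P ∘ ≡.sym)
                λ ua → apart here (outside⇒b v∉P) (commonIn⇒↝ ua uv)

        v→a : Arc D v a
        v→a = arc-unless-reversed v∉P
                λ av → apart here (outside⇒b u∉P) (commonOut⇒↝ av uv)

      data Class (v : Fin m) : Fin 4 → Set where
        out-nbr : part D v ≢ P → Arc D a v → Class v 0F
        middle  : b ↝ v → part D v ≡ P → Class v 1F
        in-nbr  : part D v ≢ P → Arc D v a → Class v 2F
        comp-a  : a ↝ v → Class v 3F

      class-unique : ∀ {v i j} → Class v i → Class v j → i ≡ j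
      class-unique (out-nbr _ _)   (out-nbr _ _)   = refl
      class-unique (out-nbr v∉P _) (middle _ v∈P)  = ⊥-elim (v∉P v∈P)
      class-unique (out-nbr _ av)  (in-nbr _ va)   = ⊥-elim (oriented D _ _ av va)
      class-unique (out-nbr v∉P _) (comp-a a↝v)    = ⊥-elim (v∉P (confined a↝v))
      class-unique (middle _ v∈P)  (out-nbr v∉P _) = ⊥-elim (v∉P v∈P)
      class-unique (middle _ _)    (middle _ _)    = refl
      class-unique (middle _ v∈P)  (in-nbr v∉P _)  = ⊥-elim (v∉P v∈P)
      class-unique (middle b↝v _)  (comp-a a↝v)    = ⊥-elim (apart a↝v b↝v here)
      class-unique (in-nbr _ va)   (out-nbr _ av)  = ⊥-elim (oriented D _ _ av va)
      class-unique (in-nbr v∉P _)  (middle _ v∈P)  = ⊥-elim (v∉P v∈P)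
      class-unique (in-nbr _ _)    (in-nbr _ _)    = refl
      class-unique (in-nbr v∉P _)  (comp-a a↝v)    = ⊥-elim (v∉P (confined a↝v))
      class-unique (comp-a a↝v)    (out-nbr v∉P _) = ⊥-elim (v∉P (confined a↝v))
      class-unique (comp-a a↝v)    (middle b↝v _)  = ⊥-elim (apart a↝v b↝v here)
      class-unique (comp-a a↝v)    (in-nbr v∉P _)  = ⊥-elim (v∉P (confined a↝v))
      class-unique (comp-a _)      (comp-a _)      = refl

      neighbour-class : ∀ {v} → part D v ≢ P → Class v 0F ⊎ Class v 2F
      neighbour-class {v} v∉P =
        Sum.map (out-nbr v∉P) (in-nbr v∉P) (complete D a v (v∉P ∘ ≡.sym))

      out-nbr⇒b : ∀ {s} → Class s 0F → b ↝ s
      out-nbr⇒b (out-nbr s∉P _) = outside⇒b s∉P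

      in-nbr⇒b : ∀ {t} → Class t 2F → b ↝ t
      in-nbr⇒b (in-nbr t∉P _) = outside⇒b t∉P

      out-nbrs-share-part : ∀ {u v} → Class u 0F → Class v 0F → part D u ≡ part D v
      out-nbrs-share-part {u} {v} (out-nbr u∉P au) (out-nbr v∉P av)
        with part D u ≟ᶠ part D v
      ... | yes same  = same
      ... | no differ = ⊥-elim
            ([ (λ uv → oriented D a v av (proj₂ (outside-arc-triangle u∉P v∉P uv)))
             , (λ vu → oriented D a u au (proj₂ (outside-arc-triangle v∉P u∉P vu))) ]′
             (complete D u v differ))

      in-nbrs-share-part : ∀ {u v} → Class u 2F → Class v 2F → part D u ≡ part D v
      in-nbrs-share-part {u} {v} (in-nbr u∉P ua) (in-nbr v∉P va)
        with part D u ≟ᶠ part D v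
      ... | yes same  = same
      ... | no differ = ⊥-elim
            ([ (λ uv → oriented D u a ua (proj₁ (outside-arc-triangle u∉P v∉P uv)))
             , (λ vu → oriented D v a va (proj₁ (outside-arc-triangle v∉P u∉P vu))) ]′
             (complete D u v differ))

      out-in-parts-differ : ∀ {s t} → Class s 0F → Class t 2F → part D s ≢ part D t
      out-in-parts-differ {s} s∈S t∈T s≡t
        with vertex-avoiding k≥3 (P ∷ part D s ∷ [])
      ... | z , z∉ =
            [ (λ z∈S → z∉ 1F (out-nbrs-share-part z∈S s∈S))
            , (λ z∈T → z∉ 1F (trans (in-nbrs-share-part z∈T t∈T) (≡.sym s≡t))) ]′
            (neighbour-class (z∉ 0F))

      outside-arc-classes : ∀ {u v} → part D u ≢ P → part D v ≢ P → Arc D u v →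
                            Class u 0F × Class v 2F
      outside-arc-classes u∉P v∉P uv = ×-map (out-nbr u∉P) (in-nbr v∉P)
                                             (outside-arc-triangle u∉P v∉P uv)

      out-and-in-nbr : ∃ (λ s → Class s 0F) × ∃ (λ t → Class t 2F)
      out-and-in-nbr with vertex-avoiding (≤-trans (s≤s (s≤s z≤n)) k≥3) (P ∷ [])
      ... | z₁ , z₁∉ with vertex-avoiding k≥3 (P ∷ part D z₁ ∷ [])
      ...   | z₂ , z₂∉ with complete D z₁ z₂ (z₂∉ 1F ∘ ≡.sym)
      ...     | inj₁ z₁z₂ =
                ×-map (z₁ ,_) (z₂ ,_) (outside-arc-classes (z₁∉ 0F) (z₂∉ 0F) z₁z₂)
      ...     | inj₂ z₂z₁ =
                ×-map (z₂ ,_) (z₁ ,_) (outside-arc-classes (z₂∉ 0F) (z₁∉ 0F) z₂z₁)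

      k≡3 : ∀ {s t} → Class s 0F → Class t 2F → k ≡ 3
      k≡3 {s} {t} s∈S t∈T with m≤n⇒m<n∨m≡n k≥3
      ... | inj₂ 3≡k = ≡.sym 3≡k
      ... | inj₁ 3<k with vertex-avoiding 3<k (P ∷ part D s ∷ part D t ∷ [])
      ...   | z , z∉ = ⊥-elim
              ([ (λ z∈S → z∉ 1F (out-nbrs-share-part z∈S s∈S))
               , (λ z∈T → z∉ 2F (in-nbrs-share-part z∈T t∈T)) ]′
               (neighbour-class (z∉ 0F)))

      classify : ∀ v → ∃ (Class v)
      classify v with cover v
      ... | inj₁ a↝v = 3F , comp-a a↝v
      ... | inj₂ b↝v with part D v ≟ᶠ P
      ...   | yes v∈P = 1F , middle b↝v v∈P
      ...   | no  v∉P = [ (0F ,_) , (2F ,_) ]′ (neighbour-class v∉P)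

      π : Fin m → Fin 4
      π v = proj₁ (classify v)

      class-of : ∀ v → Class v (π v)
      class-of v = proj₂ (classify v)

      out→in : ∀ {s t} → Class s 0F → Class t 2F → Arc D s t
      out→in s∈S@(out-nbr s∉P _) t∈T@(in-nbr t∉P ta) =
        arc-unless-reversed (out-in-parts-differ s∈S t∈T)
          λ ts → oriented D _ a ta (proj₁ (outside-arc-triangle t∉P s∉P ts))

      -- Stated for arbitrary representatives: unfolding the ones chosen by out-and-in-nbr
      -- during type checking is prohibitively slow.
      module WithNeighbours {s₀ t₀ : Fin m} (s₀∈S : Class s₀ 0F) (t₀∈T : Class t₀ 2F) where

        classPart : Fin 3 → Fin k
        classPart 0F = P
        classPart 1F = part D s₀
        classPart 2F = part D t₀

        part-via-class : ∀ {v i} → Class v i → part D v ≡ classPart (patternPart i)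
        part-via-class v∈S@(out-nbr _ _) = out-nbrs-share-part v∈S s₀∈S
        part-via-class (middle _ v∈P)    = v∈P
        part-via-class v∈T@(in-nbr _ _)  = in-nbrs-share-part v∈T t₀∈T
        part-via-class (comp-a a↝v)      = confined a↝v

        lift : ∀ {i j x y} → PatternArc i j → Class x i → Class y j → Arc D x y
        lift arc₃₀ (comp-a a↝x) y∈S@(out-nbr y∉P _) =
          arc-unless-reversed (λ x≡y → y∉P (trans (≡.sym x≡y) (confined a↝x)))
            λ yx → apart a↝x (in-nbr⇒b t₀∈T) (commonIn⇒↝ yx (out→in y∈S t₀∈T))
        lift arc₀₂ x∈S y∈T = out→in x∈S y∈T
        lift arc₂₃ x∈T@(in-nbr x∉P _) (comp-a a↝y) =
          arc-unless-reversed (λ x≡y → x∉P (trans x≡y (confined a↝y)))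
            λ yx → apart a↝y (out-nbr⇒b s₀∈S) (commonOut⇒↝ yx (out→in s₀∈S x∈T))
        lift arc₀₁ (out-nbr x∉P ax) (middle b↝y y∈P) =
          arc-unless-reversed (λ x≡y → x∉P (trans x≡y y∈P))
            λ yx → apart here b↝y (commonOut⇒↝ ax yx)
        lift arc₁₂ (middle b↝x x∈P) (in-nbr y∉P ya) =
          arc-unless-reversed (λ x≡y → y∉P (trans (≡.sym x≡y) x∈P))
            λ yx → apart here b↝x (commonIn⇒↝ ya yx)

        arc⇔ : ∀ x y → Arc D x y ⇔ PatternArc (π x) (π y)
        arc⇔ = arcs-determined D Pattern π classPart (part-via-class ∘ class-of)
                 λ {x} {y} r → lift r (class-of x) (class-of y)

        open PatternBlowUp D π arc⇔

        π-surjective : ∀ j → ∃ λ v → π v ≡ j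
        π-surjective 0F = s₀ , class-unique (class-of s₀) s₀∈S
        -- M is nonempty because S and T lie in the same component.
        π-surjective 1F = walk-meets-middle π (proj₂ ∘ nicheAdj⇒expansionAdj)
                            (Reach-trans (Reach-sym (out-nbr⇒b s₀∈S)) (in-nbr⇒b t₀∈T))
                            (class-unique (class-of s₀) s₀∈S)
                            (class-unique (class-of t₀) t₀∈T)
        π-surjective 2F = t₀ , class-unique (class-of t₀) t₀∈T
        π-surjective 3F = a , class-unique (class-of a) (comp-a here)

        expansion : k ≡ 3 × IsoToExpansionOf (NicheGraph D) P3∪K1
        expansion = k≡3 s₀∈S t₀∈T , π , π-surjective , nicheAdj⇔expansionAdj π-surjective

      expansion : k ≡ 3 × IsoToExpansionOf (NicheGraph D) P3∪K1
      expansion with out-and-in-nbr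
      ... | (_ , s∈S) , (_ , t∈T) = WithNeighbours.expansion s∈S t∈T

  twoComponents⇒expansion : 3 ≤ k → TwoComponents (NicheGraph D) →
                            k ≡ 3 × IsoToExpansionOf (NicheGraph D) P3∪K1
  twoComponents⇒expansion k≥3 (a , b , a↮b , cover) =
    by-cases A.confined-or-spread B.confined-or-spread
    where
    module A = Components k≥3 a b a↮b cover
    module B = Components k≥3 b a (a↮b ∘ Reach-sym) (Sum.swap ∘ cover)

    by-cases : Confined a ⊎ Spread a → Confined b ⊎ Spread b →
               k ≡ 3 × IsoToExpansionOf (NicheGraph D) P3∪K1
    by-cases (inj₁ a-confined) _                 = A.WhenConfined.expansion a-confined
    by-cases (inj₂ _)          (inj₁ b-confined) = B.WhenConfined.expansion b-confined
    by-cases (inj₂ a-spread)   (inj₂ b-spread)   = ⊥-elim (A.¬both-spread a-spread b-spread)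

theorem3p8 : ∀ {n : ℕ} (G : Graph n) → TwoComponents G →
    (k : ℕ) → 3 ≤ k →
    (NicheRealizable G k ⇔ (k ≡ 3 × IsoToExpansionOf G P3∪K1))
theorem3p8 G two-components k k≥3 = mk⇔ realizable⇒expansion expansion⇒realizable′
  where
  realizable⇒expansion : NicheRealizable G k → k ≡ 3 × IsoToExpansionOf G P3∪K1
  realizable⇒expansion (_ , D , G≅N) =
    ×-map id (≅-IsoToExpansionOf G≅N {K = P3∪K1})
      (Niche.twoComponents⇒expansion D k≥3 (≅-TwoComponents G≅N two-components))

  expansion⇒realizable′ : k ≡ 3 × IsoToExpansionOf G P3∪K1 → NicheRealizable G k
  expansion⇒realizable′ (refl , expansion) = expansion⇒realizable expansion
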